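{- Let $\mathbf{A}$ be a Bochvar algebra and let $\{\mathbf{A}_i\}_{i\in I}$, $(I,\vee,i_0)$, $\{p_{ij}\}_{i\le j}$ be the Płonka decomposition of its involutive-bisemilattice reduct. Then: (1) if $a,b\in A_i$ for some $i\in I$, then $J_1a=J_1b$; (2) if $a\in A_{i_0}$ then $J_1a=0$; (3) if $a=\neg a$ then $J_1 a=1$; (4) $p_{i_0i}(J_1a)=a\wedge\neg a$ for every $i\in I$ and every $a\in A_i$.
   Context: Let $\mathbf{WK}^e$ be the three-element algebra on $\{0,\tfrac12,1\}$ with $\neg 1=0,\neg\tfrac12=\tfrac12,\neg0=1$; $\vee,\wedge$ equal to $\tfrac12$ when one argument is $\tfrac12$ and Boolean otherwise; $J_0:0\mapsto1,\tfrac12\mapsto0,1\mapsto0$; $J_1:\tfrac12\mapsto1$, $0,1\mapsto 0$; $J_2:1\mapsto1$, $0,\tfrac12\mapsto0$. Bochvar algebras are the members of the quasivariety $\mathsf{BCA}=ISP(\mathbf{WK}^e)$ (equivalently, the quasivariety axiomatized by Finn–Grigolia). The $\{\wedge,\vee,\neg,0,1\}$-reduct of every Bochvar algebra is an involutive bisemilattice, and every involutive bisemilattice is (uniquely up to isomorphism) a Płonka sum of Boolean algebras: there are a join-semilattice $(I,\vee)$ with least element $i_0$ (order $\le$), Boolean algebras $\mathbf{A}_i$ ($i\in I$, the fibers) with pairwise disjoint universes, and Boolean homomorphisms $p_{ij}:\mathbf{A}_i\to\mathbf{A}_j$ for $i\le j$ with $p_{ii}=\mathrm{id}$ and $p_{jk}\circ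 p_{ij}=p_{ik}$, such that $A=\bigcup_i A_i$, each $n$-ary operation $g$ is computed by $g(a_1,\dots,a_n)=g^{\mathbf{A}_k}(p_{i_1k}(a_1),\dots,p_{i_nk}(a_n))$ with $a_m\in A_{i_m}$ and $k=i_1\vee\dots\vee i_n$, and constants are those of $\mathbf{A}_{i_0}$. This is called the Płonka decomposition of the reduct. -}

module Defs where

open import Level using (Level; 0ℓ)
open import Data.Product using (Σ; _×_; _,_)
open import Relation.Binary.PropositionalEquality using (_≡_)
open import Algebra.Lattice using (IsBooleanAlgebra)

data K3 : Set where
  𝟎 ½ 𝟏 : K3

¬ₖ_ : K3 → K3
¬ₖ 𝟎 = 𝟏
¬ₖ ½ = ½
¬ₖ 𝟏 = 𝟎

_∧ₖ_ : K3 → K3 → K3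
½ ∧ₖ _ = ½
𝟎 ∧ₖ ½ = ½
𝟏 ∧ₖ ½ = ½
𝟎 ∧ₖ 𝟎 = 𝟎
𝟎 ∧ₖ 𝟏 = 𝟎
𝟏 ∧ₖ 𝟎 = 𝟎
𝟏 ∧ₖ 𝟏 = 𝟏

_∨ₖ_ : K3 → K3 → K3
½ ∨ₖ _ = ½
𝟎 ∨ₖ ½ = ½
𝟏 ∨ₖ ½ = ½
𝟎 ∨ₖ 𝟎 = 𝟎
𝟎 ∨ₖ 𝟏 = 𝟏
𝟏 ∨ₖ 𝟎 = 𝟏
𝟏 ∨ₖ 𝟏 = 𝟏

J₀ₖ : K3 → K3
J₀ₖ 𝟎 = 𝟏
J₀ₖ ½ = 𝟎
J₀ₖ 𝟏 = 𝟎

J₁ₖ : K3 → K3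
J₁ₖ 𝟎 = 𝟎
J₁ₖ ½ = 𝟏
J₁ₖ 𝟏 = 𝟎

J₂ₖ : K3 → K3
J₂ₖ 𝟎 = 𝟎
J₂ₖ ½ = 𝟎
J₂ₖ 𝟏 = 𝟏

-- An algebra in the signature (∧, ∨, ¬, J₀, J₁, J₂, 0, 1) belongs to
-- ISP(WK^e) iff it embeds (injective homomorphism) into a power
-- (WK^e)^X for some index set X; elements of the power are functions
-- X → K3 with pointwise operations.

record BochvarAlgebra : Set₁ where
  infixr 6 _∧_
  infixr 5 _∨_
  field
    Carrier : Set
    _∧_ _∨_ : Carrier → Carrier → Carrier
    ¬_ J₀ J₁ J₂ : Carrier → Carrier
    𝟘 𝟙 : Carrier
    X : Set
    h : Carrier → X → K3
    h-inj : ∀ a b → (∀ x → h a x ≡ h b x) → a ≡ b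
    h-∧ : ∀ a b x → h (a ∧ b) x ≡ (h a x ∧ₖ h b x)
    h-∨ : ∀ a b x → h (a ∨ b) x ≡ (h a x ∨ₖ h b x)
    h-¬ : ∀ a x → h (¬ a) x ≡ ¬ₖ h a x
    h-J₀ : ∀ a x → h (J₀ a) x ≡ J₀ₖ (h a x)
    h-J₁ : ∀ a x → h (J₁ a) x ≡ J₁ₖ (h a x)
    h-J₂ : ∀ a x → h (J₂ a) x ≡ J₂ₖ (h a x)
    h-𝟘 : ∀ x → h 𝟘 x ≡ 𝟎
    h-𝟙 : ∀ x → h 𝟙 x ≡ 𝟏

-- * (I, ⊔) is a join-semilattice with least element i₀; i ≤ j iff i ⊔ j ≡ j.
-- * B i is the universe of the fiber A_i, a Boolean algebra with
--   operations ∨ᵢ, ∧ᵢ, ¬ᵢ, ⊤ᵢ, ⊥ᵢ.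
-- * ι i : B i → A identifies B i with the subset A_i of A; the fibers are
--   pairwise disjoint and cover A, i.e. ι is a bijection Σ I B ≅ A
--   (with inverse ρ).
-- * p : i ≤ j → B i → B j are the Boolean homomorphisms p_ij, with
--   p_ii = id and p_jk ∘ p_ij = p_ik.
-- * the operations of A are computed by the Płonka-sum rule, and the
--   constants of A are those of the fiber at i₀.

record PlonkaDecomposition (𝐀 : BochvarAlgebra) : Set₁ where
  open BochvarAlgebra 𝐀
  field
    I : Set
    _⊔_ : I → I → I
    i₀ : I
    ⊔-idem : ∀ i → (i ⊔ i) ≡ i
    ⊔-comm : ∀ i j → (i ⊔ j) ≡ (j ⊔ i)
    ⊔-assoc : ∀ i j k → ((i ⊔ j) ⊔ k) ≡ (i ⊔ (j ⊔ k))
    i₀-least : ∀ i → (i₀ ⊔ i) ≡ i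

  _≤_ : I → I → Set
  i ≤ j = (i ⊔ j) ≡ j

  field
    B : I → Set
    ∨ᵢ : (i : I) → B i → B i → B i
    ∧ᵢ : (i : I) → B i → B i → B i
    ¬ᵢ : (i : I) → B i → B i
    ⊤ᵢ : (i : I) → B i
    ⊥ᵢ : (i : I) → B i
    isBooleanAlgebra : (i : I) →
      IsBooleanAlgebra _≡_ (∨ᵢ i) (∧ᵢ i) (¬ᵢ i) (⊤ᵢ i) (⊥ᵢ i)
    ι : (i : I) → B i → Carrier
    ρ : Carrier → Σ I B
    ι-ρ : ∀ a → (let (i , x) = ρ a in ι i x) ≡ a
    ρ-ι : ∀ i x → ρ (ι i x) ≡ (i , x)
    p : {i j : I} → i ≤ j → B i → B j
    p-id : ∀ {i} (e : i ≤ i) x → p e x ≡ x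
    p-comp : ∀ {i j k} (e₁ : i ≤ j) (e₂ : j ≤ k) (e₃ : i ≤ k) x →
      p e₂ (p e₁ x) ≡ p e₃ x
    p-∨ : ∀ {i j} (e : i ≤ j) x y → p e (∨ᵢ i x y) ≡ ∨ᵢ j (p e x) (p e y)
    p-∧ : ∀ {i j} (e : i ≤ j) x y → p e (∧ᵢ i x y) ≡ ∧ᵢ j (p e x) (p e y)
    p-¬ : ∀ {i j} (e : i ≤ j) x → p e (¬ᵢ i x) ≡ ¬ᵢ j (p e x)
    p-⊤ : ∀ {i j} (e : i ≤ j) → p e (⊤ᵢ i) ≡ ⊤ᵢ j
    p-⊥ : ∀ {i j} (e : i ≤ j) → p e (⊥ᵢ i) ≡ ⊥ᵢ j
    ∧-sum : ∀ i j x y (e₁ : i ≤ (i ⊔ j)) (e₂ : j ≤ (i ⊔ j)) →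
      (ι i x ∧ ι j y) ≡ ι (i ⊔ j) (∧ᵢ (i ⊔ j) (p e₁ x) (p e₂ y))
    ∨-sum : ∀ i j x y (e₁ : i ≤ (i ⊔ j)) (e₂ : j ≤ (i ⊔ j)) →
      (ι i x ∨ ι j y) ≡ ι (i ⊔ j) (∨ᵢ (i ⊔ j) (p e₁ x) (p e₂ y))
    ¬-sum : ∀ i x → (¬ ι i x) ≡ ι i (¬ᵢ i x)
    𝟘-sum : 𝟘 ≡ ι i₀ (⊥ᵢ i₀)
    𝟙-sum : 𝟙 ≡ ι i₀ (⊤ᵢ i₀)

module _ (𝐀 : BochvarAlgebra) (D : PlonkaDecomposition 𝐀) where
  open BochvarAlgebra 𝐀
  open PlonkaDecomposition D

  Lemma2p7-Conclusion : Set
  Lemma2p7-Conclusion =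
    (∀ i (x y : B i) → J₁ (ι i x) ≡ J₁ (ι i y))
    × (∀ (x : B i₀) → J₁ (ι i₀ x) ≡ 𝟘)
    × (∀ (a : Carrier) → a ≡ ¬ a → J₁ a ≡ 𝟙)
    × (∀ i (x : B i) → Σ (B i₀) λ z →
         (J₁ (ι i x) ≡ ι i₀ z)
         × (∀ (e : i₀ ≤ i) → ι i (p e z) ≡ (ι i x ∧ ¬ ι i x)))

-- Fibers are detected pointwise in WK^e: a and b lie in the same fiber
-- exactly when a ∨ (a ∧ b) = a and b ∨ (b ∧ a) = b, and in WK^e the
-- first equation says that every coordinate where b is ½ is one where a
-- is ½.  Since J₁ only records where its argument is ½, it is constant
-- on fibers.  Moreover J₁ a never takes the value ½, so J₁ a ∧ ¬ J₁ a = 0,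
-- which places J₁ a in the bottom fiber; finally p_{i₀i}(z) = z ∧ 1_i and
-- 1_i = a ∨ ¬ a, and J₁ a ∧ (a ∨ ¬ a) = a ∧ ¬ a holds coordinatewise.
module Submission where

open import Defs
open import Data.Product using (Σ; _×_; _,_; proj₁)
open import Relation.Binary.PropositionalEquality
open import Algebra.Lattice.Bundles using (BooleanAlgebra)
import Algebra.Lattice.Properties.BooleanAlgebra as BooleanAlgebraProperties

module WKᵉ where

  J₁ₖ-absorptive : ∀ u v → (u ∨ₖ (u ∧ₖ v)) ≡ u → (v ∨ₖ (v ∧ₖ u)) ≡ v →
                   J₁ₖ u ≡ J₁ₖ v
  J₁ₖ-absorptive 𝟎 𝟎 _  _  = refl
  J₁ₖ-absorptive 𝟎 𝟏 _  _  = refl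
  J₁ₖ-absorptive 𝟏 𝟎 _  _  = refl
  J₁ₖ-absorptive 𝟏 𝟏 _  _  = refl
  J₁ₖ-absorptive ½ ½ _  _  = refl
  J₁ₖ-absorptive 𝟎 ½ () _
  J₁ₖ-absorptive 𝟏 ½ () _
  J₁ₖ-absorptive ½ 𝟎 _  ()
  J₁ₖ-absorptive ½ 𝟏 _  ()

  J₁ₖ-fixed-¬ : ∀ u → u ≡ (¬ₖ u) → J₁ₖ u ≡ 𝟏
  J₁ₖ-fixed-¬ ½ _ = refl

  J₁ₖ-∧-¬J₁ₖ : ∀ u → (J₁ₖ u ∧ₖ (¬ₖ (J₁ₖ u))) ≡ 𝟎
  J₁ₖ-∧-¬J₁ₖ 𝟎 = refl
  J₁ₖ-∧-¬J₁ₖ ½ = refl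
  J₁ₖ-∧-¬J₁ₖ 𝟏 = refl

  J₁ₖ-∧-excluded-middle : ∀ u → (J₁ₖ u ∧ₖ (u ∨ₖ (¬ₖ u))) ≡ (u ∧ₖ (¬ₖ u))
  J₁ₖ-∧-excluded-middle 𝟎 = refl
  J₁ₖ-∧-excluded-middle ½ = refl
  J₁ₖ-∧-excluded-middle 𝟏 = refl

module BochvarProperties (𝐀 : BochvarAlgebra) where
  open BochvarAlgebra 𝐀
  open WKᵉ

  J₁-absorptive : ∀ a b → a ∨ a ∧ b ≡ a → b ∨ b ∧ a ≡ b → J₁ a ≡ J₁ b
  J₁-absorptive a b ab ba = h-inj _ _ λ x → begin
    h (J₁ a) x   ≡⟨ h-J₁ a x ⟩
    J₁ₖ (h a x)  ≡⟨ J₁ₖ-absorptive _ _ (h-absorptive a b ab x) (h-absorptive b a ba x) ⟩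
    J₁ₖ (h b x)  ≡⟨ h-J₁ b x ⟨
    h (J₁ b) x   ∎
    where
    open ≡-Reasoning
    h-absorptive : ∀ c d → c ∨ c ∧ d ≡ c → ∀ x → (h c x ∨ₖ (h c x ∧ₖ h d x)) ≡ h c x
    h-absorptive c d eq x rewrite sym (h-∧ c d x) | sym (h-∨ c (c ∧ d) x) =
      cong (λ e → h e x) eq

  J₁-𝟘 : J₁ 𝟘 ≡ 𝟘
  J₁-𝟘 = h-inj _ _ λ x → begin
    h (J₁ 𝟘) x   ≡⟨ h-J₁ 𝟘 x ⟩
    J₁ₖ (h 𝟘 x)  ≡⟨ cong J₁ₖ (h-𝟘 x) ⟩
    𝟎            ≡⟨ h-𝟘 x ⟨
    h 𝟘 x        ∎
    where open ≡-Reasoning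

  J₁-fixed-¬ : ∀ a → a ≡ ¬ a → J₁ a ≡ 𝟙
  J₁-fixed-¬ a a≡¬a = h-inj _ _ λ x → begin
    h (J₁ a) x   ≡⟨ h-J₁ a x ⟩
    J₁ₖ (h a x)  ≡⟨ J₁ₖ-fixed-¬ (h a x) (trans (cong (λ b → h b x) a≡¬a) (h-¬ a x)) ⟩
    𝟏            ≡⟨ h-𝟙 x ⟨
    h 𝟙 x        ∎
    where open ≡-Reasoning

  J₁-∧-¬J₁ : ∀ a → J₁ a ∧ ¬ J₁ a ≡ 𝟘
  J₁-∧-¬J₁ a = h-inj _ _ pointwise
    where
    pointwise : ∀ x → h (J₁ a ∧ ¬ J₁ a) x ≡ h 𝟘 x
    pointwise x rewrite h-∧ (J₁ a) (¬ J₁ a) x | h-¬ (J₁ a) x | h-J₁ a x | h-𝟘 x =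
      J₁ₖ-∧-¬J₁ₖ (h a x)

  J₁-∧-excluded-middle : ∀ a → J₁ a ∧ (a ∨ ¬ a) ≡ a ∧ ¬ a
  J₁-∧-excluded-middle a = h-inj _ _ pointwise
    where
    pointwise : ∀ x → h (J₁ a ∧ (a ∨ ¬ a)) x ≡ h (a ∧ ¬ a) x
    pointwise x rewrite h-∧ (J₁ a) (a ∨ ¬ a) x | h-∨ a (¬ a) x | h-∧ a (¬ a) x
                      | h-¬ a x | h-J₁ a x =
      J₁ₖ-∧-excluded-middle (h a x)

module PlonkaProperties {𝐀 : BochvarAlgebra} (D : PlonkaDecomposition 𝐀) where
  open BochvarAlgebra 𝐀
  open PlonkaDecomposition D

  fiber : I → BooleanAlgebra _ _
  fiber i = record { isBooleanAlgebra = isBooleanAlgebra i }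

  module Fiber (i : I) where
    open BooleanAlgebra (fiber i) public
    open BooleanAlgebraProperties (fiber i) public

  ≤-⊔ˡ : ∀ i j → i ≤ (i ⊔ j)
  ≤-⊔ˡ i j = begin
    i ⊔ (i ⊔ j)  ≡⟨ ⊔-assoc i i j ⟨
    (i ⊔ i) ⊔ j  ≡⟨ cong (_⊔ j) (⊔-idem i) ⟩
    i ⊔ j        ∎
    where open ≡-Reasoning

  ≤-⊔ʳ : ∀ i j → j ≤ (i ⊔ j)
  ≤-⊔ʳ i j = begin
    j ⊔ (i ⊔ j)  ≡⟨ cong (j ⊔_) (⊔-comm i j) ⟩
    j ⊔ (j ⊔ i)  ≡⟨ ≤-⊔ˡ j i ⟩
    j ⊔ i        ≡⟨ ⊔-comm j i ⟩
    i ⊔ j        ∎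
    where open ≡-Reasoning

  p-irrelevant : ∀ {i j} (e e′ : i ≤ j) x → p e x ≡ p e′ x
  p-irrelevant {j = j} e e′ x =
    trans (sym (p-id (⊔-idem j) (p e x))) (p-comp e (⊔-idem j) e′ x)

  ∧-sum-≤ : ∀ {i j} (e : i ≤ j) x y → ι i x ∧ ι j y ≡ ι j (∧ᵢ j (p e x) y)
  ∧-sum-≤ {i} {j} e x y = trans (∧-sum i j x y (≤-⊔ˡ i j) (≤-⊔ʳ i j)) (along e _ _)
    where
    along : ∀ {k} (k≡j : k ≡ j) (e₁ : i ≤ k) (e₂ : j ≤ k) →
            ι k (∧ᵢ k (p e₁ x) (p e₂ y)) ≡ ι j (∧ᵢ j (p e x) y)
    along refl e₁ e₂ = cong₂ (λ u v → ι j (∧ᵢ j u v)) (p-irrelevant e₁ e x) (p-id e₂ y)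

  ∨-sum-≤ : ∀ {i j} (e : i ≤ j) x y → ι i x ∨ ι j y ≡ ι j (∨ᵢ j (p e x) y)
  ∨-sum-≤ {i} {j} e x y = trans (∨-sum i j x y (≤-⊔ˡ i j) (≤-⊔ʳ i j)) (along e _ _)
    where
    along : ∀ {k} (k≡j : k ≡ j) (e₁ : i ≤ k) (e₂ : j ≤ k) →
            ι k (∨ᵢ k (p e₁ x) (p e₂ y)) ≡ ι j (∨ᵢ j (p e x) y)
    along refl e₁ e₂ = cong₂ (λ u v → ι j (∨ᵢ j u v)) (p-irrelevant e₁ e x) (p-id e₂ y)

  ι-∧ : ∀ i x y → ι i x ∧ ι i y ≡ ι i (∧ᵢ i x y)
  ι-∧ i x y = trans (∧-sum-≤ (⊔-idem i) x y) (cong (λ u → ι i (∧ᵢ i u y)) (p-id _ x))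

  ι-∨ : ∀ i x y → ι i x ∨ ι i y ≡ ι i (∨ᵢ i x y)
  ι-∨ i x y = trans (∨-sum-≤ (⊔-idem i) x y) (cong (λ u → ι i (∨ᵢ i u y)) (p-id _ x))

  ι-absorptive : ∀ i x y → ι i x ∨ ι i x ∧ ι i y ≡ ι i x
  ι-absorptive i x y = begin
    ι i x ∨ ι i x ∧ ι i y       ≡⟨ cong (ι i x ∨_) (ι-∧ i x y) ⟩
    ι i x ∨ ι i (∧ᵢ i x y)      ≡⟨ ι-∨ i x (∧ᵢ i x y) ⟩
    ι i (∨ᵢ i x (∧ᵢ i x y))     ≡⟨ cong (ι i) (Fiber.∨-absorbs-∧ i x y) ⟩
    ι i x                       ∎
    where open ≡-Reasoning

  ι-excluded-middle : ∀ i x → ι i x ∨ ¬ ι i x ≡ ι i (⊤ᵢ i)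
  ι-excluded-middle i x = begin
    ι i x ∨ ¬ ι i x             ≡⟨ cong (ι i x ∨_) (¬-sum i x) ⟩
    ι i x ∨ ι i (¬ᵢ i x)        ≡⟨ ι-∨ i x (¬ᵢ i x) ⟩
    ι i (∨ᵢ i x (¬ᵢ i x))       ≡⟨ cong (ι i) (Fiber.∨-complementʳ i x) ⟩
    ι i (⊤ᵢ i)                  ∎
    where open ≡-Reasoning

  ∧-⊤-≡-p : ∀ {i j} (e : i ≤ j) z → ι i z ∧ ι j (⊤ᵢ j) ≡ ι j (p e z)
  ∧-⊤-≡-p {j = j} e z =
    trans (∧-sum-≤ e z (⊤ᵢ j)) (cong (ι j) (Fiber.∧-identityʳ j (p e z)))

  ι-fiber-injective : ∀ {i j x y} → ι i x ≡ ι j y → i ≡ j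
  ι-fiber-injective {i} {j} {x} {y} eq =
    cong proj₁ (trans (sym (ρ-ι i x)) (trans (cong ρ eq) (ρ-ι j y)))

  ∧-¬≡𝟘⇒∈A₀ : ∀ c → c ∧ ¬ c ≡ 𝟘 → Σ (B i₀) λ z → c ≡ ι i₀ z
  ∧-¬≡𝟘⇒∈A₀ c c∧¬c≡𝟘 with ρ c | ι-ρ c
  ... | j , y | ιy≡c = in-i₀ (ι-fiber-injective ιy∧¬y≡⊥)
    where
    ιy∧¬y≡⊥ : ι j (∧ᵢ j y (¬ᵢ j y)) ≡ ι i₀ (⊥ᵢ i₀)
    ιy∧¬y≡⊥ = begin
      ι j (∧ᵢ j y (¬ᵢ j y))  ≡⟨ ι-∧ j y (¬ᵢ j y) ⟨
      ι j y ∧ ι j (¬ᵢ j y)   ≡⟨ cong (ι j y ∧_) (¬-sum j y) ⟨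
      ι j y ∧ ¬ ι j y        ≡⟨ cong (λ a → a ∧ ¬ a) ιy≡c ⟩
      c ∧ ¬ c                ≡⟨ c∧¬c≡𝟘 ⟩
      𝟘                      ≡⟨ 𝟘-sum ⟩
      ι i₀ (⊥ᵢ i₀)           ∎
      where open ≡-Reasoning
    in-i₀ : j ≡ i₀ → Σ (B i₀) λ z → c ≡ ι i₀ z
    in-i₀ refl = y , sym ιy≡c

lemma2p7 : (𝐀 : BochvarAlgebra) (D : PlonkaDecomposition 𝐀) → Lemma2p7-Conclusion 𝐀 D
lemma2p7 𝐀 D = J₁-fiberwise , J₁-A₀ , J₁-fixed-¬ , J₁-projects
  where
  open BochvarAlgebra 𝐀
  open PlonkaDecomposition D
  open BochvarProperties 𝐀
  open PlonkaProperties D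

  J₁-fiberwise : ∀ i (x y : B i) → J₁ (ι i x) ≡ J₁ (ι i y)
  J₁-fiberwise i x y = J₁-absorptive _ _ (ι-absorptive i x y) (ι-absorptive i y x)

  J₁-A₀ : ∀ (x : B i₀) → J₁ (ι i₀ x) ≡ 𝟘
  J₁-A₀ x = trans (J₁-fiberwise i₀ x (⊥ᵢ i₀)) (trans (cong J₁ (sym 𝟘-sum)) J₁-𝟘)

  J₁-projects : ∀ i (x : B i) → Σ (B i₀) λ z →
    (J₁ (ι i x) ≡ ι i₀ z) × (∀ (e : i₀ ≤ i) → ι i (p e z) ≡ (ι i x ∧ ¬ ι i x))
  J₁-projects i x with ∧-¬≡𝟘⇒∈A₀ (J₁ (ι i x)) (J₁-∧-¬J₁ (ι i x))
  ... | z , J₁a≡z = z , J₁a≡z , λ e → begin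
    ι i (p e z)                   ≡⟨ ∧-⊤-≡-p e z ⟨
    ι i₀ z ∧ ι i (⊤ᵢ i)           ≡⟨ cong₂ _∧_ (sym J₁a≡z) (sym (ι-excluded-middle i x)) ⟩
    J₁ (ι i x) ∧ (ι i x ∨ ¬ ι i x) ≡⟨ J₁-∧-excluded-middle (ι i x) ⟩
    ι i x ∧ ¬ ι i x               ∎
    where open ≡-Reasoning
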